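{- The Mephisto Waltz sequence $\mathbf{mw}$ is $3$-pseudoperiodic, but not $2$-pseudoperiodic.
   Context: The Mephisto Waltz sequence $\mathbf{mw}=001001110\cdots$ is the infinite fixed point, starting with $0$, of the morphism $0\mapsto001$, $1\mapsto110$; it is indexed from $0$. For integers $k\ge1$ and $0<p_1<\cdots<p_k$, an infinite word $\mathbf{s}$ has pseudoperiod $(p_1,\ldots,p_k)$ if $\mathbf{s}[i]\in\{\mathbf{s}[i+p_1],\ldots,\mathbf{s}[i+p_k]\}$ for all $i\ge0$; it is $k$-pseudoperiodic if it has some pseudoperiod with exactly $k$ entries. -}

module Defs where

open import Data.Nat using (ℕ; zero; suc; _+_; _<_)
open import Data.Nat.DivMod using (_/_; _%_)
open import Data.Bool using (Bool; true; false)
open import Data.List using (List; _∷_; []; length)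
open import Data.Product using (Σ; ∃; _×_; _,_)
open import Data.Fin using (Fin)
open import Data.List.Membership.Propositional using (_∈_)
open import Data.List.Relation.Unary.Linked using (Linked)
open import Data.List.Relation.Unary.All using (All)
open import Relation.Binary.PropositionalEquality using (_≡_)

-- Letters: false = 0, true = 1.
-- The Mephisto Waltz morphism 0 ↦ 001, 1 ↦ 110, as a function giving the
-- r-th letter (r < 3) of the image of a letter.
μ : Bool → ℕ → Bool
μ false 0 = false
μ false 1 = false
μ false _ = true
μ true  0 = true
μ true  1 = true
μ true  _ = false

-- Since μ is 3-uniform, the fixed point starting with 0 satisfies
-- mw[3q + r] = μ(mw[q])[r] and mw[0] = 0.  We compute it with fuel
-- (fuel n suffices for index n, as n / 3 < n for n ≥ 1).
mwFuel : ℕ → ℕ → Bool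
mwFuel zero     _       = false
mwFuel (suc f)  zero    = false
mwFuel (suc f)  (suc n) = μ (mwFuel f (suc n / 3)) (suc n % 3)

mw : ℕ → Bool
mw n = mwFuel n n

HasPseudoperiod : (ℕ → Bool) → List ℕ → Set
HasPseudoperiod s ps =
  All (0 <_) ps × Linked _<_ ps ×
  (∀ i → ∃ λ p → p ∈ ps × s i ≡ s (i + p))

PseudoPeriodic : ℕ → (ℕ → Bool) → Set
PseudoPeriodic k s = ∃ λ ps → length ps ≡ k × HasPseudoperiod s ps

{-# OPTIONS --safe #-}
-- Write δ i p = mw[i] xor mw[i+p].  Since mw[3j+r] = mw[j] xor [r = 2], splitting
-- i = r + 3i' and r + p = u + 3c with r, u < 3 gives
-- δ(r + 3i', p) = ([r = 2] xor [u = 2]) xor δ(i', c), so every pattern of the pair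
-- (δ i p, δ i q) is, up to a fixed flip, a pattern at the carries (c, e).  For
-- 0 < p < q a suitable digit r gives 0 < c < e < q, except for (1,2), (1,3), (2,3),
-- where all four patterns occur within the first six positions.  By induction on q
-- every pattern occurs, in particular (true, true), which no pseudoperiod (p, q)
-- allows.  The same identity shows that each i agrees with i+1, i+3 or i+4.
module Submission where

open import Defs
open import Algebra using (CommutativeRing)
open import Data.Bool using (Bool; true; false; not; _xor_)
open import Data.Bool.Properties
  using (xor-∧-commutativeRing; xor-assoc; xor-same; xor-identityʳ)
open import Data.List using (List; _∷_; [])
open import Data.List.Relation.Unary.All using (_∷_; [])
open import Data.List.Relation.Unary.Any using (here; there)
open import Data.List.Membership.Propositional using (_∈_)
open import Data.List.Relation.Unary.Linked using (_∷_; [-])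
open import Data.Nat
open import Data.Nat.Divisibility using (n∣m*n)
open import Data.Nat.DivMod
open import Data.Nat.Induction using (<-rec)
open import Data.Nat.Properties
open import Data.Nat.Tactic.RingSolver using (solve-∀)
open import Data.Product using (_×_; _,_; ∃)
open import Data.Sum using (inj₁; inj₂)
open import Relation.Binary.PropositionalEquality
open import Relation.Nullary using (¬_)

open import Algebra.Properties.CommutativeSemigroup
  (CommutativeRing.+-commutativeSemigroup xor-∧-commutativeRing)
  using (interchange)

[1+n]/3≤n : ∀ n → suc n / 3 ≤ n
[1+n]/3≤n n = s≤s⁻¹ (m/n<m (suc n) 3 (s<s z<s))

mwFuel-stable : ∀ {f g n} → n ≤ f → n ≤ g → mwFuel f n ≡ mwFuel g n
mwFuel-stable {zero}  {zero}  {zero}  _ _ = refl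
mwFuel-stable {zero}  {suc g} {zero}  _ _ = refl
mwFuel-stable {suc f} {zero}  {zero}  _ _ = refl
mwFuel-stable {suc f} {suc g} {zero}  _ _ = refl
mwFuel-stable {suc f} {suc g} {suc n} (s≤s n≤f) (s≤s n≤g) =
  cong (λ x → μ x (suc n % 3))
       (mwFuel-stable (≤-trans ([1+n]/3≤n n) n≤f) (≤-trans ([1+n]/3≤n n) n≤g))

mw-rec : ∀ n → mw n ≡ μ (mw (n / 3)) (n % 3)
mw-rec zero    = refl
mw-rec (suc n) = cong (λ x → μ x (suc n % 3)) (mwFuel-stable ([1+n]/3≤n n) ≤-refl)

mw-digit : ∀ r j → r < 3 → mw (r + j * 3) ≡ μ (mw j) r
mw-digit r j r<3 = begin
  mw (r + j * 3)                             ≡⟨ mw-rec (r + j * 3) ⟩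
  μ (mw ((r + j * 3) / 3)) ((r + j * 3) % 3) ≡⟨ cong₂ (λ m k → μ (mw m) k) quotient remainder ⟩
  μ (mw j) r                                 ∎
  where
  open ≡-Reasoning
  quotient : (r + j * 3) / 3 ≡ j
  quotient = trans (+-distrib-/-∣ʳ r (n∣m*n j))
                   (cong₂ _+_ (m<n⇒m/n≡0 r<3) (m*n/n≡m j 3))
  remainder : (r + j * 3) % 3 ≡ r
  remainder = trans ([m+kn]%n≡m%n r j 3) (m<n⇒m%n≡m r<3)

μ≡μ-false-xor : ∀ x r → μ x r ≡ μ false r xor x
μ≡μ-false-xor false r             = sym (xor-identityʳ (μ false r))
μ≡μ-false-xor true  0             = refl
μ≡μ-false-xor true  1             = refl
μ≡μ-false-xor true  (suc (suc r)) = refl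

≡⇒xor≡false : ∀ {x y} → x ≡ y → x xor y ≡ false
≡⇒xor≡false {x} refl = xor-same x

δ : ℕ → ℕ → Bool
δ i p = mw i xor mw (i + p)

δ-same : ∀ i → δ i 0 ≡ false
δ-same i = ≡⇒xor≡false (cong mw (sym (+-identityʳ i)))

xor≡false⇒≡ : ∀ x y → x xor y ≡ false → x ≡ y
xor≡false⇒≡ false false _ = refl
xor≡false⇒≡ true  true  _ = refl

xor-cancelˡ : ∀ x y → x xor (x xor y) ≡ y
xor-cancelˡ x y = trans (sym (xor-assoc x x y)) (cong (_xor y) (xor-same x))

Carry : ℕ → ℕ → ℕ → Set
Carry r p c = ∃ λ u → u < 3 × r + p ≡ u + c * 3

δ-digit : ∀ r p c i → r < 3 → ((u , _ , _) : Carry r p c) →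
          δ (r + i * 3) p ≡ (μ false r xor μ false u) xor δ i c
δ-digit r p c i r<3 (u , u<3 , carry) = begin
  mw (r + i * 3) xor mw (r + i * 3 + p)
    ≡⟨ cong₂ _xor_ (mw-digit r i r<3)
                   (trans (cong mw shift) (mw-digit u (i + c) u<3)) ⟩
  μ (mw i) r xor μ (mw (i + c)) u
    ≡⟨ cong₂ _xor_ (μ≡μ-false-xor (mw i) r) (μ≡μ-false-xor (mw (i + c)) u) ⟩
  (μ false r xor mw i) xor (μ false u xor mw (i + c))
    ≡⟨ interchange (μ false r) (mw i) (μ false u) (mw (i + c)) ⟩
  (μ false r xor μ false u) xor δ i c
    ∎
  where
  open ≡-Reasoning
  shift : r + i * 3 + p ≡ u + (i + c) * 3
  shift = begin
    r + i * 3 + p       ≡⟨ reorder r i p ⟩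
    (r + p) + i * 3     ≡⟨ cong (_+ i * 3) carry ⟩
    (u + c * 3) + i * 3 ≡⟨ regroup u c i ⟩
    u + (i + c) * 3     ∎
    where
    reorder : ∀ r i p → r + i * 3 + p ≡ (r + p) + i * 3
    reorder = solve-∀
    regroup : ∀ u c i → (u + c * 3) + i * 3 ≡ u + (i + c) * 3
    regroup = solve-∀

AllPatterns : ℕ → ℕ → Set
AllPatterns p q = ∀ α β → ∃ λ i → δ i p ≡ α × δ i q ≡ β

Reduces : ℕ → ℕ → ℕ → ℕ → Set
Reduces p q c e = ∃ λ r → r < 3 × Carry r p c × Carry r q e

allPatterns-reduce : ∀ {p q c e} → Reduces p q c e → AllPatterns c e → AllPatterns p q
allPatterns-reduce (r , r<3 , p-carry@(u , _) , q-carry@(v , _)) patterns α β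
  with patterns ((μ false r xor μ false u) xor α) ((μ false r xor μ false v) xor β)
... | i , δ-c , δ-e = r + i * 3 , lift p-carry δ-c , lift q-carry δ-e
  where
  lift : ∀ {p c γ} → ((w , _) : Carry r p c) →
         δ i c ≡ (μ false r xor μ false w) xor γ → δ (r + i * 3) p ≡ γ
  lift {p} {c} {γ} carry@(w , _) δ-i = begin
    δ (r + i * 3) p  ≡⟨ δ-digit r p c i r<3 carry ⟩
    ε xor δ i c      ≡⟨ cong (ε xor_) δ-i ⟩
    ε xor (ε xor γ)  ≡⟨ xor-cancelˡ ε γ ⟩
    γ                ∎
    where
    open ≡-Reasoning
    ε : Bool
    ε = μ false r xor μ false w

allPatterns-1-2 : AllPatterns 1 2
allPatterns-1-2 false false = 5 , refl , refl
allPatterns-1-2 false true  = 0 , refl , refl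
allPatterns-1-2 true  false = 1 , refl , refl
allPatterns-1-2 true  true  = 2 , refl , refl

allPatterns-1-3 : AllPatterns 1 3
allPatterns-1-3 false false = 0 , refl , refl
allPatterns-1-3 false true  = 3 , refl , refl
allPatterns-1-3 true  false = 1 , refl , refl
allPatterns-1-3 true  true  = 4 , refl , refl

allPatterns-2-3 : AllPatterns 2 3
allPatterns-2-3 false false = 1 , refl , refl
allPatterns-2-3 false true  = 5 , refl , refl
allPatterns-2-3 true  false = 0 , refl , refl
allPatterns-2-3 true  true  = 3 , refl , refl

data Descent (p q : ℕ) : Set where
  solved : AllPatterns p q → Descent p q
  reduced : ∀ {c e} → Reduces p q c e → 0 < c → c < e → e < q → Descent p q

n<n*3 : ∀ n .{{_ : NonZero n}} → n < n * 3
n<n*3 n = m<m*n n 3 (s<s z<s)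

n<t+n*3 : ∀ n .{{_ : NonZero n}} t → n < t + n * 3
n<t+n*3 n t = <-≤-trans (n<n*3 n) (m≤n+m (n * 3) t)

1+n<t+n*3 : ∀ n .{{_ : NonZero n}} t → 0 < t → suc n < t + n * 3
1+n<t+n*3 n t 0<t = +-mono-≤-< 0<t (n<n*3 n)

carry-2 : ∀ {s} → 0 < s + 0 * 3 → s < 3 → Carry 2 (s + 0 * 3) 1
carry-2 {1} _ _ = 0 , z<s , refl
carry-2 {2} _ _ = 1 , s<s z<s , refl
carry-2 {suc (suc (suc _))} _ (s<s (s<s (s<s ())))

descent-firstBlock : ∀ {s t} b → 0 < s + 0 * 3 → s < 3 → t < 3 → 0 < b →
                     Descent (s + 0 * 3) (t + b * 3)
descent-firstBlock {1} {0} 1 _ _ _ _ = solved allPatterns-1-3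
descent-firstBlock {2} {0} 1 _ _ _ _ = solved allPatterns-2-3
descent-firstBlock {suc (suc (suc _))} {0} 1 _ (s<s (s<s (s<s ()))) _ _
descent-firstBlock {t = 0} b@(suc (suc _)) 0<p s<3 _ _ =
  reduced (2 , s<s (s<s z<s) , carry-2 0<p s<3 , (2 , s<s (s<s z<s) , refl))
          z<s (s<s z<s) (n<t+n*3 b 0)
descent-firstBlock {t = 1} b@(suc _) 0<p s<3 _ _ =
  reduced (2 , s<s (s<s z<s) , carry-2 0<p s<3 , (0 , z<s , refl))
          z<s (s<s z<s) (1+n<t+n*3 b 1 z<s)
descent-firstBlock {t = 2} b@(suc _) 0<p s<3 _ _ =
  reduced (2 , s<s (s<s z<s) , carry-2 0<p s<3 , (1 , s<s z<s , refl))
          z<s (s<s z<s) (1+n<t+n*3 b 2 z<s)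
descent-firstBlock {t = suc (suc (suc _))} _ _ _ (s<s (s<s (s<s ()))) _

descent-sameBlock : ∀ {s t} a → 0 < s + a * 3 → s < t → t < 3 →
                    Descent (s + a * 3) (t + a * 3)
descent-sameBlock {1} {2} zero _ _ _ = solved allPatterns-1-2
descent-sameBlock {0} {1} (suc a) _ _ _ =
  reduced (2 , s<s (s<s z<s) , (2 , s<s (s<s z<s) , refl) , (0 , z<s , refl))
          z<s (n<1+n (suc a)) (1+n<t+n*3 (suc a) 1 z<s)
descent-sameBlock {0} {2} (suc a) _ _ _ =
  reduced (2 , s<s (s<s z<s) , (2 , s<s (s<s z<s) , refl) , (1 , s<s z<s , refl))
          z<s (n<1+n (suc a)) (1+n<t+n*3 (suc a) 2 z<s)
descent-sameBlock {1} {2} (suc a) _ _ _ =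
  reduced (1 , s<s z<s , (2 , s<s (s<s z<s) , refl) , (0 , z<s , refl))
          z<s (n<1+n (suc a)) (1+n<t+n*3 (suc a) 2 z<s)
descent-sameBlock {0} {_} zero () _ _
descent-sameBlock {suc _} {1} _ _ (s<s ()) _
descent-sameBlock {suc (suc _)} {2} _ _ (s<s (s<s ())) _
descent-sameBlock {t = suc (suc (suc _))} _ _ _ (s<s (s<s (s<s ())))

descent-lowerBlock : ∀ {s t} a b → 0 < s + a * 3 → s < 3 → t < 3 → a < b →
                     Descent (s + a * 3) (t + b * 3)
descent-lowerBlock zero    b       0<p s<3 t<3 0<b = descent-firstBlock b 0<p s<3 t<3 0<b
descent-lowerBlock {s} {t} (suc a) (suc b) _ s<3 t<3 a<b =
  reduced (0 , z<s , (s , s<3 , refl) , (t , t<3 , refl)) z<s a<b (n<t+n*3 (suc b) t)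

data Base3 : ℕ → Set where
  base3 : ∀ s a → s < 3 → Base3 (s + a * 3)

toBase3 : ∀ n → Base3 n
toBase3 n = subst Base3 (sym (m≡m%n+[m/n]*n n 3)) (base3 (n % 3) (n / 3) (m%n<n n 3))

block-mono : ∀ {s t a b} → t < 3 → s + a * 3 < t + b * 3 → a ≤ b
block-mono {s} {t} {a} {b} t<3 p<q = ≮⇒≥ λ b<a → <-asym p<q (begin-strict
  t + b * 3 <⟨ +-monoˡ-< (b * 3) t<3 ⟩
  suc b * 3 ≤⟨ *-monoˡ-≤ 3 b<a ⟩
  a * 3     ≤⟨ m≤n+m (a * 3) s ⟩
  s + a * 3 ∎)
  where open ≤-Reasoning

descent : ∀ {p q} → 0 < p → p < q → Descent p q
descent {p} {q} 0<p p<q with toBase3 p | toBase3 q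
... | base3 s a s<3 | base3 t b t<3 with m≤n⇒m<n∨m≡n (block-mono {s} t<3 p<q)
...   | inj₁ a<b  = descent-lowerBlock a b 0<p s<3 t<3 a<b
...   | inj₂ refl = descent-sameBlock a 0<p (+-cancelʳ-< (a * 3) s t p<q) t<3

allPatterns : ∀ {p q} → 0 < p → p < q → AllPatterns p q
allPatterns {q = q} = <-rec (λ q → ∀ {p} → 0 < p → p < q → AllPatterns p q) go q
  where
  go : ∀ q → (∀ {e} → e < q → ∀ {c} → 0 < c → c < e → AllPatterns c e) →
       ∀ {p} → 0 < p → p < q → AllPatterns p q
  go q smaller 0<p p<q with descent 0<p p<q
  ... | solved patterns             = patterns
  ... | reduced reduces 0<c c<e e<q = allPatterns-reduce reduces (smaller e<q 0<c c<e)

someShift-δ≡false : ∀ {i p q ps} → p ∈ ps → q ∈ ps → δ i p ≡ not (δ i q) →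
                    ∃ λ r → r ∈ ps × δ i r ≡ false
someShift-δ≡false {i} {q = q} p∈ps q∈ps δp with δ i q in δq
... | false = q , q∈ps , δq
... | true  = _ , p∈ps , δp

periods : List ℕ
periods = 1 ∷ 3 ∷ 4 ∷ []

period-1-3-4 : ∀ i → ∃ λ p → p ∈ periods × δ i p ≡ false
period-1-3-4 i with toBase3 i
... | base3 0 k _ = 1 , here refl , trans (δ-digit 0 1 0 k z<s (1 , s<s z<s , refl)) (δ-same k)
... | base3 1 k _ = someShift-δ≡false {1 + k * 3} (there (there (here refl))) (there (here refl))
  (trans (δ-digit 1 4 1 k (s<s z<s) (2 , s<s (s<s z<s) , refl))
         (cong not (sym (δ-digit 1 3 1 k (s<s z<s) (1 , s<s z<s , refl)))))
... | base3 2 k _ = someShift-δ≡false {2 + k * 3} (here refl) (there (here refl))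
  (trans (δ-digit 2 1 1 k (s<s (s<s z<s)) (0 , z<s , refl))
         (cong not (sym (δ-digit 2 3 1 k (s<s (s<s z<s)) (2 , s<s (s<s z<s) , refl)))))
... | base3 (suc (suc (suc _))) _ (s<s (s<s (s<s ())))

mw-hasPseudoperiod-1-3-4 : HasPseudoperiod mw periods
mw-hasPseudoperiod-1-3-4 = (z<s ∷ z<s ∷ z<s ∷ []) , (s<s z<s ∷ n<1+n 3 ∷ [-]) , agrees
  where
  agrees : ∀ i → ∃ λ p → p ∈ periods × mw i ≡ mw (i + p)
  agrees i with period-1-3-4 i
  ... | p , p∈periods , δ≡false =
    p , p∈periods , xor≡false⇒≡ (mw i) (mw (i + p)) δ≡false

δ≡true⇒≢ : ∀ i p → δ i p ≡ true → mw i ≢ mw (i + p)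
δ≡true⇒≢ i p δ≡true same with () ← trans (sym δ≡true) (≡⇒xor≡false same)

mw-not-2-pseudoperiodic : ¬ PseudoPeriodic 2 mw
mw-not-2-pseudoperiodic (p ∷ q ∷ [] , refl , (0<p ∷ _) , (p<q ∷ _) , agrees)
  with allPatterns 0<p p<q true true
... | i , δp , δq with agrees i
...   | _ , here refl         , same = δ≡true⇒≢ i p δp same
...   | _ , there (here refl) , same = δ≡true⇒≢ i q δq same

proposition20 : PseudoPeriodic 3 mw × ¬ PseudoPeriodic 2 mw
proposition20 = (periods , refl , mw-hasPseudoperiod-1-3-4) , mw-not-2-pseudoperiodic
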